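{- Let $T$ be a forest on $n \geq 1$ vertices and let $\epsilon \geq 0$. Then $T$ has a vertex $v$ that is either an $(\epsilon,2)$-split vertex or an $(\epsilon,3)$-split vertex.
   Context: A vertex $v$ of a forest $T$ on $n$ vertices is an $(\epsilon,2)$-split vertex if $T \setminus \{v\}$ (the subgraph induced by $V(T)\setminus\{v\}$) is the disjoint union $T_1 \uplus T_2$ of two (possibly empty) subgraphs with no edges between them, with $|V(T_1)|,|V(T_2)| \leq (\frac12+\epsilon)n$. It is an $(\epsilon,3)$-split vertex if $T\setminus\{v\}$ is the disjoint union $T_1 \uplus T_2 \uplus T_3$ of three (possibly empty) subgraphs with no edges between them, with $|V(T_1)|,|V(T_2)|,|V(T_3)| \leq (\frac12-\epsilon)n$.
   Formalization: The parameter ε ranges over the nonnegative rationals. -}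

module Defs where

open import Data.Bool using (Bool; true; false)
open import Data.Nat using (ℕ; _≥_)
open import Data.Fin using (Fin; _≟_)
open import Data.List using (List; []; _∷_; length; filter; _++_; [_])
open import Data.List.Relation.Unary.Unique.Propositional using (Unique)
open import Data.List.Relation.Unary.Linked using (Linked)
open import Data.Integer using (+_)
open import Data.Rational using (ℚ; _/_; _+_; _-_; _*_; _≤_; ½)
open import Data.Product using (Σ; _×_; ∃)
open import Relation.Binary.PropositionalEquality using (_≡_; _≢_)
open import Relation.Nullary using (¬_)
open import Relation.Nullary.Decidable using (¬?; _×-dec_)
open import Data.List using (allFin)
open import Data.Empty using (⊥)

record Graph (n : ℕ) : Set where
  field
    adj    : Fin n → Fin n → Bool
    sym    : ∀ u v → adj u v ≡ adj v u
    irrefl : ∀ v → adj v v ≡ false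

open Graph public

Adj : ∀ {n} → Graph n → Fin n → Fin n → Set
Adj G u v = adj G u v ≡ true

IsCycle : ∀ {n} → Graph n → List (Fin n) → Set
IsCycle G [] = ⊥
IsCycle G (v ∷ vs) =
  (length (v ∷ vs) ≥ 3) × Unique (v ∷ vs) × Linked (Adj G) (v ∷ vs ++ [ v ])

IsForest : ∀ {n} → Graph n → Set
IsForest {n} G = ∀ (c : List (Fin n)) → ¬ IsCycle G c

ℕtoℚ : ℕ → ℚ
ℕtoℚ k = + k / 1

partSize : ∀ {n k} → Fin n → (Fin n → Fin k) → Fin k → ℕ
partSize {n} v col i =
  length (filter (λ w → ¬? (w ≟ v) ×-dec (col w ≟ i)) (allFin n))

-- v splits G into k parts (a colouring of V(G) ∖ {v} by Fin k, the colour of v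
-- itself being irrelevant) with no edges between distinct parts, each part
-- having at most `bound` vertices (bound a rational).
IsSplit : ∀ {n} → Graph n → (k : ℕ) → ℚ → Fin n → Set
IsSplit {n} G k bound v =
  Σ (Fin n → Fin k) λ col →
    (∀ w w' → w ≢ v → w' ≢ v → Adj G w w' → col w ≡ col w')
    × (∀ i → ℕtoℚ (partSize v col i) ≤ bound)

Is2Split : ∀ {n} → Graph n → ℚ → Fin n → Set
Is2Split {n} G ε v = IsSplit G 2 ((½ + ε) * ℕtoℚ n) v

Is3Split : ∀ {n} → Graph n → ℚ → Fin n → Set
Is3Split {n} G ε v = IsSplit G 3 ((½ - ε) * ℕtoℚ n) v

module Submission where

open import Defs renaming (sym to adj-sym)
open import Data.Nat using (ℕ)

-- The proof is a descent.  A state is a vertex v together with a union X of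
-- components of T − v with |X| > lower.  If |X| ≤ upper, then X and the rest of
-- T − v form a 2-split at v (the rest has fewer than n − lower = upper vertices).
-- Otherwise the rest has fewer than lower vertices and we look at the neighbours
-- of v in X.  If there are two, u and u', acyclicity puts them in different
-- components of T − v, so X = C ⊎ Y with C the component of u and both parts
-- nonempty: either one of them is still larger than lower (a smaller state), or
-- C, Y and the rest form a 3-split at v.  If v has at most one neighbour in X, we
-- move the centre to a suitable u ∈ X and keep X ∖ {u}, which is a union of
-- components of T − u; again either it is larger than lower (a smaller state) or
-- u is a 2-split vertex.  Since |X| strictly decreases, the descent terminates.

module RationalBounds where

  open import Data.Nat as ℕ using (ℕ; zero; suc)
  import Data.Nat.Properties as ℕP
  open import Data.Nat.Divisibility using (∣1⇒≡1)
  open import Data.Integer as ℤ using (+_)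
  import Data.Integer.Properties as ℤP
  open import Data.Rational
  open import Data.Rational.Properties
  import Data.Rational.Unnormalised as ℚᵘ
  import Data.Rational.Unnormalised.Properties as ℚᵘP
  open import Data.Rational.Solver using (module +-*-Solver)
  open import Data.Product using (proj₂)
  open import Relation.Binary.PropositionalEquality
  open import Relation.Nullary using (contradiction)

  ℕtoℚ≡k/1 : ∀ k → ℕtoℚ k ≡ mkℚ (+ k) 0 (λ d∣k×d∣1 → ∣1⇒≡1 (proj₂ d∣k×d∣1))
  ℕtoℚ≡k/1 k = normalize-coprime (λ d∣k×d∣1 → ∣1⇒≡1 (proj₂ d∣k×d∣1))

  ℕtoℚ-+ : ∀ p q → ℕtoℚ (p ℕ.+ q) ≡ ℕtoℚ p + ℕtoℚ q
  ℕtoℚ-+ p q = toℚᵘ-injective (ℚᵘP.≃-trans sum (ℚᵘP.≃-sym (ℚᵘP.≃-trans (toℚᵘ-homo-+ (ℕtoℚ p) (ℕtoℚ q)) summands)))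
    where
    sum : toℚᵘ (ℕtoℚ (p ℕ.+ q)) ℚᵘ.≃ ℚᵘ.mkℚᵘ (+ (p ℕ.+ q)) 0
    sum rewrite ℕtoℚ≡k/1 (p ℕ.+ q) = ℚᵘP.≃-refl
    summands : toℚᵘ (ℕtoℚ p) ℚᵘ.+ toℚᵘ (ℕtoℚ q) ℚᵘ.≃ ℚᵘ.mkℚᵘ (+ (p ℕ.+ q)) 0
    summands rewrite ℕtoℚ≡k/1 p | ℕtoℚ≡k/1 q = ℚᵘ.*≡* (begin
        (+ p ℤ.* + 1 ℤ.+ + q ℤ.* + 1) ℤ.* + 1 ≡⟨ ℤP.*-identityʳ _ ⟩
        + p ℤ.* + 1 ℤ.+ + q ℤ.* + 1           ≡⟨ cong₂ ℤ._+_ (ℤP.*-identityʳ (+ p)) (ℤP.*-identityʳ (+ q)) ⟩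
        + p ℤ.+ + q                           ≡⟨ ℤP.pos-+ p q ⟨
        + (p ℕ.+ q)                           ≡⟨ ℤP.*-identityʳ _ ⟨
        + (p ℕ.+ q) ℤ.* + 1                   ∎)
      where open ≡-Reasoning

  ℕtoℚ-nonNeg : ∀ k → 0ℚ ≤ ℕtoℚ k
  ℕtoℚ-nonNeg k = nonNegative⁻¹ (ℕtoℚ k) {{normalize-nonNeg k 1}}

  ℕtoℚ-mono : ∀ {p q} → p ℕ.≤ q → ℕtoℚ p ≤ ℕtoℚ q
  ℕtoℚ-mono {p} {q} p≤q = begin
    ℕtoℚ p                    ≡⟨ +-identityʳ (ℕtoℚ p) ⟨
    ℕtoℚ p + 0ℚ               ≤⟨ +-monoʳ-≤ (ℕtoℚ p) (ℕtoℚ-nonNeg (q ℕ.∸ p)) ⟩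
    ℕtoℚ p + ℕtoℚ (q ℕ.∸ p)   ≡⟨ ℕtoℚ-+ p (q ℕ.∸ p) ⟨
    ℕtoℚ (p ℕ.+ (q ℕ.∸ p))    ≡⟨ cong ℕtoℚ (ℕP.m+[n∸m]≡n p≤q) ⟩
    ℕtoℚ q                    ∎
    where open ≤-Reasoning

  exceeds-nonNeg⇒pos : ∀ {b} k → 0ℚ ≤ b → b < ℕtoℚ k → 0 ℕ.< k
  exceeds-nonNeg⇒pos zero    0≤b b<0 = contradiction (≤-<-trans 0≤b b<0) (<-irrefl refl)
  exceeds-nonNeg⇒pos (suc k) _   _   = ℕ.z<s

  complement-≤ : ∀ p q {n x y} → p ℕ.+ q ℕ.≤ n → x < ℕtoℚ q → x + y ≡ ℕtoℚ n → ℕtoℚ p ≤ y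
  complement-≤ p q {n} {x} {y} p+q≤n x<q x+y≡n = ≮⇒≥ λ y<p → <-irrefl refl (begin-strict
    x + y                 <⟨ +-mono-< x<q y<p ⟩
    ℕtoℚ q + ℕtoℚ p       ≡⟨ ℕtoℚ-+ q p ⟨
    ℕtoℚ (q ℕ.+ p)        ≡⟨ cong ℕtoℚ (ℕP.+-comm q p) ⟩
    ℕtoℚ (p ℕ.+ q)        ≤⟨ ℕtoℚ-mono p+q≤n ⟩
    ℕtoℚ n                ≡⟨ x+y≡n ⟨
    x + y                 ∎)
    where open ≤-Reasoning

  module Thresholds (ε : ℚ) (n : ℕ) where

    lower upper : ℚ
    lower = (½ - ε) * ℕtoℚ n
    upper = (½ + ε) * ℕtoℚ n

    lower+upper : lower + upper ≡ ℕtoℚ n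
    lower+upper = solve 2 (λ e N → (con ½ :- e) :* N :+ (con ½ :+ e) :* N := N) refl ε (ℕtoℚ n)
      where open +-*-Solver

    upper+lower : upper + lower ≡ ℕtoℚ n
    upper+lower = trans (+-comm upper lower) lower+upper

    module _ (0≤ε : 0ℚ ≤ ε) where

      lower≤upper : lower ≤ upper
      lower≤upper = *-monoʳ-≤-nonNeg (ℕtoℚ n) {{normalize-nonNeg n 1}}
        (+-monoʳ-≤ ½ (≤-trans (neg-antimono-≤ 0≤ε) 0≤ε))

      upper-nonNeg : 0ℚ ≤ upper
      upper-nonNeg = nonNegative⁻¹ upper {{nonNeg*nonNeg⇒nonNeg (½ + ε) {{½+ε-nonNeg}} (ℕtoℚ n) {{normalize-nonNeg n 1}}}}
        where
        ½+ε-nonNeg : NonNegative (½ + ε)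
        ½+ε-nonNeg = nonNeg+nonNeg⇒nonNeg ½ {{normalize-nonNeg 1 2}} ε {{nonNegative 0≤ε}}

module Subsets where

  open import Data.Nat using (ℕ; zero; suc; _+_; _≤_; _<_; z≤n; s≤s; z<s)
  import Data.Nat.Properties as ℕP
  open import Data.Bool using (Bool; true; false; _∧_; _∨_; not)
  import Data.Bool.Properties as 𝔹P
  open import Data.Fin using (Fin; zero; suc; _≟_)
  open import Data.List using (length; filter; tabulate)
  open import Data.Product using (∃; _×_; _,_)
  open import Function using (_∘_)
  open import Relation.Binary.PropositionalEquality
  open import Relation.Nullary using (does; yes; no; contradiction)
  open import Relation.Nullary.Decidable using (dec-true; dec-false)
  open import Relation.Unary using (Pred; Decidable)
  open import Algebra.Properties.CommutativeSemigroup ℕP.+-commutativeSemigroup using (interchange)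

  Subset : ℕ → Set
  Subset n = Fin n → Bool

  module _ {n : ℕ} where

    ⁅_⁆ : Fin n → Subset n
    ⁅ w ⁆ x = does (x ≟ w)

    ∁ : Subset n → Subset n
    ∁ X x = not (X x)

    _∪_ _∖_ : Subset n → Subset n → Subset n
    (X ∪ A) x = X x ∨ A x
    (X ∖ A) x = X x ∧ not (A x)

    _⊆_ : Subset n → Subset n → Set
    A ⊆ X = ∀ {w} → A w ≡ true → X w ≡ true

    ⁅⁆-self : ∀ w → ⁅ w ⁆ w ≡ true
    ⁅⁆-self w = dec-true (w ≟ w) refl

    ⁅⁆-other : ∀ {x w} → x ≢ w → ⁅ w ⁆ x ≡ false
    ⁅⁆-other {x} {w} = dec-false (x ≟ w)

    ∪⁅⁆-self : ∀ (X : Subset n) w → (X ∪ ⁅ w ⁆) w ≡ true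
    ∪⁅⁆-self X w = trans (cong (X w ∨_) (⁅⁆-self w)) (𝔹P.∨-zeroʳ (X w))

    ∖-intro : ∀ {X A : Subset n} {w} → X w ≡ true → A w ≡ false → (X ∖ A) w ≡ true
    ∖-intro Xw Aw rewrite Xw | Aw = refl

    ∖-elim : ∀ {X A : Subset n} {w} → (X ∖ A) w ≡ true → X w ≡ true × A w ≡ false
    ∖-elim {X} {A} {w} w∈X∖A with X w | A w
    ... | true | false = refl , refl

    ⊆-absent : ∀ {X A : Subset n} {w} → A ⊆ X → X w ≡ false → A w ≡ false
    ⊆-absent {A = A} {w} A⊆X Xw with A w in Aw
    ... | true  = trans (sym (A⊆X Aw)) Xw
    ... | false = refl

    ⁅⁆-member : ∀ {x w} → ⁅ w ⁆ x ≡ true → x ≡ w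
    ⁅⁆-member {x} {w} x∈⁅w⁆ with x ≟ w
    ... | yes x≡w = x≡w
    ... | no  _   = contradiction x∈⁅w⁆ λ ()

  bit : Bool → ℕ
  bit true  = 1
  bit false = 0

  bit-split : ∀ a b → bit a ≡ bit (a ∧ b) + bit (a ∧ not b)
  bit-split true  true  = refl
  bit-split true  false = refl
  bit-split false _     = refl

  count : ∀ {n} → Subset n → ℕ
  count {zero}  X = 0
  count {suc n} X = bit (X zero) + count (X ∘ suc)

  count-ext : ∀ {n} {X A : Subset n} → (∀ w → X w ≡ A w) → count X ≡ count A
  count-ext {zero}  X≗A = refl
  count-ext {suc n} X≗A = cong₂ _+_ (cong bit (X≗A zero)) (count-ext (X≗A ∘ suc))

  count-≤ : ∀ {n} (X : Subset n) → count X ≤ n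
  count-≤ {zero}  X = z≤n
  count-≤ {suc n} X with X zero
  ... | true  = s≤s (count-≤ (X ∘ suc))
  ... | false = ℕP.m≤n⇒m≤1+n (count-≤ (X ∘ suc))

  count-split : ∀ {n} (X A : Subset n) → count X ≡ count (λ w → X w ∧ A w) + count (X ∖ A)
  count-split {zero}  X A = refl
  count-split {suc n} X A = trans
    (cong₂ _+_ (bit-split (X zero) (A zero)) (count-split (X ∘ suc) (A ∘ suc)))
    (interchange (bit (X zero ∧ A zero)) (bit (X zero ∧ not (A zero))) _ _)

  count-∖ : ∀ {n} {X A : Subset n} → A ⊆ X → count X ≡ count A + count (X ∖ A)
  count-∖ {X = X} {A} A⊆X = trans (count-split X A) (cong (_+ count (X ∖ A)) (count-ext X∩A≗A))
    where
    X∩A≗A : ∀ w → X w ∧ A w ≡ A w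
    X∩A≗A w with A w in Aw
    ... | true  = trans (cong (_∧ true) (A⊆X Aw)) refl
    ... | false = 𝔹P.∧-zeroʳ (X w)

  count-empty : ∀ n → count {n} (λ _ → false) ≡ 0
  count-empty zero    = refl
  count-empty (suc n) = count-empty n

  count-full : ∀ n → count {n} (λ _ → true) ≡ n
  count-full zero    = refl
  count-full (suc n) = cong suc (count-full n)

  count-⁅⁆ : ∀ {n} (w : Fin n) → count ⁅ w ⁆ ≡ 1
  count-⁅⁆ {suc n} zero    = cong suc (count-empty n)
  count-⁅⁆ {suc n} (suc w) = count-⁅⁆ w

  count-remove : ∀ {n} {X : Subset n} {w} → X w ≡ true → count X ≡ suc (count (X ∖ ⁅ w ⁆))
  count-remove {X = X} {w} Xw = trans (count-split X ⁅ w ⁆) (cong (_+ count (X ∖ ⁅ w ⁆)) (trans (count-ext X∩⁅w⁆≗⁅w⁆) (count-⁅⁆ w)))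
    where
    X∩⁅w⁆≗⁅w⁆ : ∀ x → X x ∧ ⁅ w ⁆ x ≡ ⁅ w ⁆ x
    X∩⁅w⁆≗⁅w⁆ x with x ≟ w
    ... | yes refl = trans (cong (_∧ true) Xw) refl
    ... | no  _    = 𝔹P.∧-zeroʳ (X x)

  count-insert : ∀ {n} {X : Subset n} {w} → X w ≡ false → count (X ∪ ⁅ w ⁆) ≡ suc (count X)
  count-insert {X = X} {w} Xw = trans (count-remove {X = X ∪ ⁅ w ⁆} (∪⁅⁆-self X w)) (cong suc (count-ext removed≗X))
    where
    removed≗X : ∀ x → ((X ∪ ⁅ w ⁆) ∖ ⁅ w ⁆) x ≡ X x
    removed≗X x with x ≟ w
    ... | yes refl = trans (𝔹P.∧-zeroʳ _) (sym Xw)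
    ... | no  _    = trans (𝔹P.∧-identityʳ _) (𝔹P.∨-identityʳ (X x))

  count-pos : ∀ {n} {X : Subset n} {w} → X w ≡ true → 0 < count X
  count-pos {X = X} Xw = subst (0 <_) (sym (count-remove {X = X} Xw)) z<s

  count-<-part : ∀ {n} {X A : Subset n} {w} → A ⊆ X → (X ∖ A) w ≡ true → count A < count X
  count-<-part {X = X} {A} A⊆X w∈X∖A = begin-strict
    count A                    ≡⟨ ℕP.+-identityʳ (count A) ⟨
    count A + 0                <⟨ ℕP.+-monoʳ-< (count A) (count-pos {X = X ∖ A} w∈X∖A) ⟩
    count A + count (X ∖ A)    ≡⟨ count-∖ {X = X} A⊆X ⟨
    count X                    ∎
    where open ℕP.≤-Reasoning

  count-<-rest : ∀ {n} {X A : Subset n} {w} → A ⊆ X → A w ≡ true → count (X ∖ A) < count X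
  count-<-rest {X = X} {A} A⊆X Aw = begin-strict
    count (X ∖ A)              <⟨ ℕP.+-monoˡ-< (count (X ∖ A)) (count-pos {X = A} Aw) ⟩
    count A + count (X ∖ A)    ≡⟨ count-∖ {X = X} A⊆X ⟨
    count X                    ∎
    where open ℕP.≤-Reasoning

  count-witness : ∀ {n} (X : Subset n) → 0 < count X → ∃ λ w → X w ≡ true
  count-witness {suc n} X 0<count with X zero in X-zero
  ... | true  = zero , X-zero
  ... | false with count-witness (X ∘ suc) 0<count
  ...   | w , Xw = suc w , Xw

  length-filter : ∀ {n a p} {A : Set a} {P : Pred A p} (P? : Decidable P) (f : Fin n → A) →
    length (filter P? (tabulate f)) ≡ count (λ x → does (P? (f x)))
  length-filter {zero}  P? f = refl
  length-filter {suc n} P? f with does (P? (f zero))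
  ... | true  = cong suc (length-filter P? (f ∘ suc))
  ... | false = length-filter P? (f ∘ suc)

module Splitting {n : ℕ} (T : Graph n) where

  open import Data.Nat as ℕ using (ℕ; zero; suc; z≤n; s≤s)
  import Data.Nat.Properties as ℕP
  open import Data.Bool using (Bool; true; false; _∧_; not) renaming (_≟_ to _≟ᵇ_)
  open import Data.Bool.Properties using (∧-zeroʳ; ∧-inverseʳ)
  open import Data.Fin using (Fin; zero; suc; _≟_)
  open import Data.Fin.Properties using (any?)
  open import Data.List using (List; []; _∷_; _++_; [_])
  open import Data.List.Relation.Unary.All as All using (All; []; _∷_)
  open import Data.List.Relation.Unary.AllPairs using (AllPairs; []; _∷_)
  open import Data.List.Relation.Unary.Linked using (Linked; [-]; _∷_)
  open import Data.Product using (∃; ∃₂; Σ; _×_; _,_; proj₁)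
  open import Data.Sum using (_⊎_; inj₁; inj₂)
  open import Relation.Binary.PropositionalEquality hiding ([_])
  open import Relation.Nullary using (Dec; does; yes; no; ¬_; ¬?; contradiction; _×-dec_)
  open import Data.Rational as ℚ using (ℚ; 0ℚ)
  import Data.Rational.Properties as ℚP
  open import Data.Nat.Induction using (<-wellFounded)
  open import Induction.WellFounded using (Acc; acc)
  open Subsets

  Adj-sym : ∀ {u w} → Adj T u w → Adj T w u
  Adj-sym {u} {w} uw = trans (adj-sym T w u) uw

  data Path (u : Fin n) : Fin n → List (Fin n) → Set where
    stop : Path u u []
    step : ∀ {w w' ys} → Adj T w w' → All (w ≢_) (w' ∷ ys) → Path u w' ys → Path u w (w' ∷ ys)

  path-distinct : ∀ {u w ys} → Path u w ys → AllPairs _≢_ (w ∷ ys)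
  path-distinct stop               = [] ∷ []
  path-distinct (step _ fresh p)   = fresh ∷ path-distinct p

  path-linked : ∀ {u w ys v} → Path u w ys → Adj T u v → Linked (Adj T) (w ∷ ys ++ [ v ])
  path-linked stop             uv = uv ∷ [-]
  path-linked (step ww' _ p)   uv = ww' ∷ path-linked p uv

  -- In a forest, a path between two distinct neighbours u, u' of v cannot
  -- avoid v: together with v it would be a cycle.
  no-detour : IsForest T → ∀ {v u u' ys} → Adj T v u → Adj T v u' → u ≢ u' →
    Path u u' ys → ¬ All (v ≢_) (u' ∷ ys)
  no-detour forest vu vu' u≢u' stop              _    = u≢u' refl
  no-detour forest {v} {u' = u'} {ys} vu vu' u≢u' p@(step _ _ _) v∉p =
    forest (v ∷ u' ∷ ys) (s≤s (s≤s (s≤s z≤n)) , v∉p ∷ path-distinct p , vu' ∷ path-linked p (Adj-sym vu))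

  record Connected (X : Subset n) (u : Fin n) (S : Subset n) : Set where
    field
      inside : S ⊆ X
      root   : S u ≡ true
      joined : ∀ {w} → S w ≡ true → ∃ λ ys → Path u w ys × All (λ x → S x ≡ true) (w ∷ ys)

  record Component (X : Subset n) (u : Fin n) : Set where
    field
      members   : Subset n
      connected : Connected X u members
      saturated : ∀ {w w'} → members w ≡ true → X w' ≡ true → Adj T w w' → members w' ≡ true
    open Connected connected public

  Frontier : Subset n → Subset n → Set
  Frontier X S = ∃₂ λ w w' → S w ≡ true × Adj T w w' × X w' ≡ true × S w' ≡ false

  frontier? : ∀ X S → Dec (Frontier X S)
  frontier? X S = any? λ w → any? λ w' →
    (S w ≟ᵇ true) ×-dec (adj T w w' ≟ᵇ true) ×-dec (X w' ≟ᵇ true) ×-dec (S w' ≟ᵇ false)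

  member-≢ : ∀ {S : Subset n} {v xs} → S v ≡ false → All (λ x → S x ≡ true) xs → All (v ≢_) xs
  member-≢ Sv = All.map λ { Sx refl → contradiction (trans (sym Sv) Sx) λ () }

  extend : ∀ {X u S w w'} → Connected X u S → S w ≡ true → Adj T w w' → X w' ≡ true → S w' ≡ false →
    Connected X u (S ∪ ⁅ w' ⁆)
  extend {X} {u} {S} {w} {w'} c Sw ww' Xw' Sw' = record
    { inside = inside'
    ; root   = grows root
    ; joined = joined'
    }
    where
    open Connected c
    grows : ∀ {x} → S x ≡ true → (S ∪ ⁅ w' ⁆) x ≡ true
    grows Sx rewrite Sx = refl
    inside' : (S ∪ ⁅ w' ⁆) ⊆ X
    inside' {x} x∈ with S x in Sx
    ... | true  = inside Sx
    ... | false = subst (λ y → X y ≡ true) (sym (⁅⁆-member x∈)) Xw'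
    joined' : ∀ {x} → (S ∪ ⁅ w' ⁆) x ≡ true → ∃ λ ys → Path u x ys × All (λ y → (S ∪ ⁅ w' ⁆) y ≡ true) (x ∷ ys)
    joined' {x} x∈ with S x in Sx
    ... | true  = let (ys , p , inS) = joined Sx in ys , p , All.map grows inS
    ... | false with ⁅⁆-member {x = x} x∈
    ...   | refl = let (ys , p , inS) = joined Sw in
                   w ∷ ys , step (Adj-sym ww') (member-≢ Sw' inS) p , ∪⁅⁆-self S x ∷ All.map grows inS

  -- Grow a connected set along frontier edges until none is left.  Each round
  -- adds a vertex, so the invariant n < fuel + |S| ensures the fuel never runs out.
  grow : ∀ {X u S} (fuel : ℕ) → Connected X u S → n ℕ.< fuel ℕ.+ count S → Component X u
  grow {S = S} zero    c bound = contradiction bound (ℕP.≤⇒≯ (count-≤ S))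
  grow {X} {u} {S} (suc fuel) c bound with frontier? X S
  ... | no none = record { members = S ; connected = c ; saturated = saturated }
    where
    saturated : ∀ {w w'} → S w ≡ true → X w' ≡ true → Adj T w w' → S w' ≡ true
    saturated {w} {w'} Sw Xw' ww' with S w' in Sw'
    ... | true  = refl
    ... | false = contradiction (w , w' , Sw , ww' , Xw' , Sw') none
  ... | yes (w , w' , Sw , ww' , Xw' , Sw') =
    grow fuel (extend c Sw ww' Xw' Sw') (subst (n ℕ.<_) bigger bound)
    where
    bigger : suc fuel ℕ.+ count S ≡ fuel ℕ.+ count (S ∪ ⁅ w' ⁆)
    bigger = trans (sym (ℕP.+-suc fuel (count S))) (cong (fuel ℕ.+_) (sym (count-insert {X = S} Sw')))

  component : ∀ {X u} → X u ≡ true → Component X u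
  component {X} {u} Xu = grow (suc n) seed (ℕP.m≤m+n (suc n) (count ⁅ u ⁆))
    where
    seed : Connected X u ⁅ u ⁆
    seed = record
      { inside = λ x∈ → subst (λ y → X y ≡ true) (sym (⁅⁆-member x∈)) Xu
      ; root   = ⁅⁆-self u
      ; joined = λ x∈ → trivial-path (⁅⁆-member x∈) x∈
      }
      where
      trivial-path : ∀ {x} → x ≡ u → ⁅ u ⁆ x ≡ true → ∃ λ ys → Path u x ys × All (λ y → ⁅ u ⁆ y ≡ true) (x ∷ ys)
      trivial-path refl x∈ = [] , stop , x∈ ∷ []

  -- X is a union of components of T − v: it avoids v and no edge of T − v
  -- leaves it.
  record Closed (v : Fin n) (X : Subset n) : Set where
    field
      avoids : X v ≡ false
      stable : ∀ {w w'} → w ≢ v → w' ≢ v → Adj T w w' → X w ≡ true → X w' ≡ true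
  open Closed

  closed-≢ : ∀ {v X w} → Closed v X → X w ≡ true → w ≢ v
  closed-≢ cl Xw refl = contradiction (trans (sym (avoids cl)) Xw) λ ()

  closed-respects : ∀ {v X w w'} → Closed v X → w ≢ v → w' ≢ v → Adj T w w' → X w ≡ X w'
  closed-respects {X = X} {w} {w'} cl w≢v w'≢v ww' with X w in Xw | X w' in Xw'
  ... | true  | true  = refl
  ... | false | false = refl
  ... | true  | false = contradiction (trans (sym Xw') (stable cl w≢v w'≢v ww' Xw)) λ ()
  ... | false | true  = contradiction (trans (sym Xw) (stable cl w'≢v w≢v (Adj-sym ww') Xw')) λ ()

  ∖-closed : ∀ {v X A} → Closed v X → Closed v A → Closed v (X ∖ A)
  ∖-closed {X = X} {A} clX clA = record
    { avoids = cong (_∧ not (A _)) (avoids clX)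
    ; stable = λ {w} {w'} w≢v w'≢v ww' w∈ → let (Xw , Aw) = ∖-elim {X = X} {A} w∈ in
        ∖-intro {X = X} {A} (stable clX w≢v w'≢v ww' Xw) (trans (sym (closed-respects clA w≢v w'≢v ww')) Aw)
    }

  component-closed : ∀ {v X u} → Closed v X → (c : Component X u) → Closed v (Component.members c)
  component-closed {X = X} cl c = record
    { avoids = ⊆-absent {X = X} {members} inside (avoids cl)
    ; stable = λ w≢v w'≢v ww' Cw → saturated Cw (stable cl w≢v w'≢v ww' (inside Cw)) ww'
    }
    where open Component c

  component-separates : IsForest T → ∀ {v X u u'} → Closed v X → (c : Component X u) →
    Adj T v u → Adj T v u' → u ≢ u' → Component.members c u' ≡ false
  component-separates forest {u' = u'} cl c vu vu' u≢u' with Component.members c u' in Cu'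
  ... | false = refl
  ... | true  = let (ys , p , inC) = joined Cu' in
    contradiction (member-≢ (avoids (component-closed cl c)) inC) (no-detour forest vu vu' u≢u' p)
    where open Component c

  shift-closed : ∀ {v X u} → Closed v X → X u ≡ true → (∀ {u'} → Adj T v u' → X u' ≡ true → u' ≡ u) →
    Closed u (X ∖ ⁅ u ⁆)
  shift-closed {v} {X} {u} cl Xu only = record
    { avoids = trans (cong (λ b → X u ∧ not b) (⁅⁆-self u)) (∧-zeroʳ (X u))
    ; stable = stable'
    }
    where
    stable' : ∀ {w w'} → w ≢ u → w' ≢ u → Adj T w w' → (X ∖ ⁅ u ⁆) w ≡ true → (X ∖ ⁅ u ⁆) w' ≡ true
    stable' {w} {w'} w≢u w'≢u ww' w∈ = ∖-intro {X = X} {⁅ u ⁆} (stable cl (closed-≢ cl Xw) w'≢v ww' Xw) (⁅⁆-other w'≢u)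
      where
      Xw : X w ≡ true
      Xw = proj₁ (∖-elim {X = X} {⁅ u ⁆} w∈)
      w'≢v : w' ≢ v
      w'≢v refl = w≢u (only (Adj-sym ww') Xw)

  outside : Fin n → Subset n → Subset n
  outside v X = ∁ ⁅ v ⁆ ∖ X

  outside-self : ∀ v X → outside v X v ≡ false
  outside-self v X = cong (λ b → not b ∧ not (X v)) (⁅⁆-self v)

  outside-≢ : ∀ {v w} X → w ≢ v → outside v X w ≡ not (X w)
  outside-≢ X w≢v = cong (λ b → not b ∧ not (X _)) (⁅⁆-other w≢v)

  count-outside : ∀ {v X} → X v ≡ false → suc (count X ℕ.+ count (outside v X)) ≡ n
  count-outside {v} {X} Xv = begin
    suc (count X ℕ.+ count (outside v X)) ≡⟨ cong suc (count-∖ {X = ∁ ⁅ v ⁆} {X} X⊆others) ⟨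
    suc (count (∁ ⁅ v ⁆))                 ≡⟨ count-remove {X = λ _ → true} {v} refl ⟨
    count {n} (λ _ → true)                ≡⟨ count-full n ⟩
    n                                     ∎
    where
    open ≡-Reasoning
    X⊆others : X ⊆ ∁ ⁅ v ⁆
    X⊆others {w} Xw = cong not (⁅⁆-other {x = w} (λ { refl → contradiction (trans (sym Xv) Xw) λ () }))

  outside+side≤n : ∀ {v X} → X v ≡ false → count (outside v X) ℕ.+ count X ℕ.≤ n
  outside+side≤n {v} {X} Xv = subst (count (outside v X) ℕ.+ count X ℕ.≤_) (count-outside Xv)
    (ℕP.≤-trans (ℕP.≤-reflexive (ℕP.+-comm (count (outside v X)) (count X))) (ℕP.n≤1+n _))

  partSize-count : ∀ {k v} {col : Fin n → Fin k} {i} (P : Subset n) → P v ≡ false →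
    (∀ {w} → w ≢ v → does (col w ≟ i) ≡ P w) → partSize v col i ≡ count P
  partSize-count {v = v} {col} {i} P Pv part = trans
    (length-filter (λ w → ¬? (w ≟ v) ×-dec (col w ≟ i)) (λ w → w))
    (count-ext pointwise)
    where
    pointwise : ∀ w → not (does (w ≟ v)) ∧ does (col w ≟ i) ≡ P w
    pointwise w with w ≟ v
    ... | yes refl = sym Pv
    ... | no  w≢v  = part w≢v

  part-≤ : ∀ {k v} {col : Fin n → Fin k} {i bound} (P : Subset n) → P v ≡ false →
    (∀ {w} → w ≢ v → does (col w ≟ i) ≡ P w) → ℕtoℚ (count P) ℚ.≤ bound → ℕtoℚ (partSize v col i) ℚ.≤ bound
  part-≤ {bound = bound} P Pv part P≤ = subst (λ k → ℕtoℚ k ℚ.≤ bound) (sym (partSize-count P Pv part)) P≤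

  side₂ : Bool → Fin 2
  side₂ true  = zero
  side₂ false = suc zero

  two-split : ∀ {v X bound} → Closed v X → ℕtoℚ (count X) ℚ.≤ bound →
    ℕtoℚ (count (outside v X)) ℚ.≤ bound → IsSplit T 2 bound v
  two-split {v} {X} {bound} cl X≤ outside≤ = colour , respects , sizes
    where
    colour : Fin n → Fin 2
    colour w = side₂ (X w)
    respects : ∀ w w' → w ≢ v → w' ≢ v → Adj T w w' → colour w ≡ colour w'
    respects w w' w≢v w'≢v ww' = cong side₂ (closed-respects cl w≢v w'≢v ww')
    in-first : ∀ b → does (side₂ b ≟ zero) ≡ b
    in-first true  = refl
    in-first false = refl
    in-second : ∀ b → does (side₂ b ≟ suc zero) ≡ not b
    in-second true  = refl
    in-second false = refl
    sizes : ∀ i → ℕtoℚ (partSize v colour i) ℚ.≤ bound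
    sizes zero       = part-≤ X (avoids cl) (λ {w} _ → in-first (X w)) X≤
    sizes (suc zero) = part-≤ (outside v X) (outside-self v X)
      (λ {w} w≢v → trans (in-second (X w)) (sym (outside-≢ X w≢v))) outside≤

  side₃ : Bool → Bool → Fin 3
  side₃ true  _     = zero
  side₃ false true  = suc zero
  side₃ false false = suc (suc zero)

  three-split : ∀ {v X A bound} → Closed v X → Closed v A → A ⊆ X →
    ℕtoℚ (count A) ℚ.≤ bound → ℕtoℚ (count (X ∖ A)) ℚ.≤ bound →
    ℕtoℚ (count (outside v X)) ℚ.≤ bound → IsSplit T 3 bound v
  three-split {v} {X} {A} {bound} clX clA A⊆X A≤ X∖A≤ outside≤ = colour , respects , sizes
    where
    colour : Fin n → Fin 3
    colour w = side₃ (A w) (X w)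
    respects : ∀ w w' → w ≢ v → w' ≢ v → Adj T w w' → colour w ≡ colour w'
    respects w w' w≢v w'≢v ww' = cong₂ side₃ (closed-respects clA w≢v w'≢v ww') (closed-respects clX w≢v w'≢v ww')
    in-first : ∀ a x → does (side₃ a x ≟ zero) ≡ a
    in-first true  _     = refl
    in-first false true  = refl
    in-first false false = refl
    in-second : ∀ a x → does (side₃ a x ≟ suc zero) ≡ x ∧ not a
    in-second true  x     = sym (∧-zeroʳ x)
    in-second false true  = refl
    in-second false false = refl
    in-third : ∀ a x → (a ≡ true → x ≡ true) → does (side₃ a x ≟ suc (suc zero)) ≡ not x
    in-third true  x     a⇒x rewrite a⇒x refl = refl
    in-third false true  _   = refl
    in-third false false _   = refl
    sizes : ∀ i → ℕtoℚ (partSize v colour i) ℚ.≤ bound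
    sizes zero             = part-≤ A (avoids clA) (λ {w} _ → in-first (A w) (X w)) A≤
    sizes (suc zero)       = part-≤ (X ∖ A) (avoids (∖-closed clX clA)) (λ {w} _ → in-second (A w) (X w)) X∖A≤
    sizes (suc (suc zero)) = part-≤ (outside v X) (outside-self v X)
      (λ {w} w≢v → trans (in-third (A w) (X w) A⊆X) (sym (outside-≢ X w≢v))) outside≤

  Branching : Fin n → Subset n → Set
  Branching v X = ∃₂ λ u u' → Adj T v u × X u ≡ true × Adj T v u' × X u' ≡ true × u ≢ u'

  branching? : ∀ v X → Dec (Branching v X)
  branching? v X = any? λ u → any? λ u' →
    (adj T v u ≟ᵇ true) ×-dec (X u ≟ᵇ true) ×-dec (adj T v u' ≟ᵇ true) ×-dec (X u' ≟ᵇ true) ×-dec ¬? (u ≟ u')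

  -- Otherwise a nonempty X contains a vertex u that is the only possible
  -- neighbour of v in X: a neighbour if there is one, any member if not.
  pivot : ∀ {v X} → 0 ℕ.< count X → ¬ Branching v X →
    ∃ λ u → X u ≡ true × (∀ {u'} → Adj T v u' → X u' ≡ true → u' ≡ u)
  pivot {v} {X} X-nonempty ¬branching with any? (λ u → (adj T v u ≟ᵇ true) ×-dec (X u ≟ᵇ true))
  ... | yes (u , vu , Xu) = u , Xu , only
    where
    only : ∀ {u'} → Adj T v u' → X u' ≡ true → u' ≡ u
    only {u'} vu' Xu' with u' ≟ u
    ... | yes u'≡u = u'≡u
    ... | no  u'≢u = contradiction (u' , u , vu' , Xu' , vu , Xu , u'≢u) ¬branching
  ... | no no-neighbour = let (u , Xu) = count-witness X X-nonempty in
    u , Xu , λ {u'} vu' Xu' → contradiction (u' , vu' , Xu') no-neighbour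

  module Descent (forest : IsForest T) (ε : ℚ) (0≤ε : 0ℚ ℚ.≤ ε) where

    open RationalBounds
    open Thresholds ε n

    Good : Set
    Good = ∃ λ v → Is2Split T ε v ⊎ Is3Split T ε v

    -- A union of components of T − centre that is too large to be a part of a
    -- 3-split.
    record State : Set where
      constructor state
      field
        centre : Fin n
        side   : Subset n
        closed : Closed centre side
        large  : lower ℚ.< ℕtoℚ (count side)
    open State

    Progress : State → Set
    Progress s = Good ⊎ Σ State λ s' → count (side s') ℕ.< count (side s)

    outside-≤-upper : ∀ {v X} → Closed v X → lower ℚ.< ℕtoℚ (count X) → ℕtoℚ (count (outside v X)) ℚ.≤ upper
    outside-≤-upper {v} {X} cl X>lower =
      complement-≤ (count (outside v X)) (count X) (outside+side≤n {v} {X} (avoids cl)) X>lower lower+upper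

    outside-≤-lower : ∀ {v X} → Closed v X → upper ℚ.< ℕtoℚ (count X) → ℕtoℚ (count (outside v X)) ℚ.≤ lower
    outside-≤-lower {v} {X} cl X>upper =
      complement-≤ (count (outside v X)) (count X) (outside+side≤n {v} {X} (avoids cl)) X>upper upper+lower

    divide : ∀ {v X C} (cl : Closed v X) (X>lower : lower ℚ.< ℕtoℚ (count X)) → upper ℚ.< ℕtoℚ (count X) →
      Closed v C → C ⊆ X → ∀ {u u'} → C u ≡ true → (X ∖ C) u' ≡ true → Progress (state v X cl X>lower)
    divide {v} {X} {C} cl X>lower X>upper C-closed C⊆X Cu u'∈X∖C =
      choose (lower ℚ.<? ℕtoℚ (count C)) (lower ℚ.<? ℕtoℚ (count (X ∖ C)))
      where
      choose : Dec (lower ℚ.< ℕtoℚ (count C)) → Dec (lower ℚ.< ℕtoℚ (count (X ∖ C))) → Progress (state v X cl X>lower)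
      choose (yes C>lower) _               = inj₂ (state v C C-closed C>lower , count-<-part {X = X} C⊆X u'∈X∖C)
      choose (no  _)       (yes X∖C>lower) = inj₂ (state v (X ∖ C) (∖-closed cl C-closed) X∖C>lower , count-<-rest {X = X} C⊆X Cu)
      choose (no  C≯lower) (no  X∖C≯lower) = inj₁ (v , inj₂
        (three-split cl C-closed C⊆X (ℚP.≮⇒≥ C≯lower) (ℚP.≮⇒≥ X∖C≯lower) (outside-≤-lower cl X>upper)))

    -- Two neighbours u ≠ u' of v in a side larger than upper: the component of u
    -- in X misses u', so it divides X.
    branch : ∀ {v X} (cl : Closed v X) (X>lower : lower ℚ.< ℕtoℚ (count X)) → upper ℚ.< ℕtoℚ (count X) →
      ∀ {u u'} → Adj T v u → X u ≡ true → Adj T v u' → X u' ≡ true → u ≢ u' → Progress (state v X cl X>lower)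
    branch {X = X} cl X>lower X>upper {u} vu Xu vu' Xu' u≢u' =
      divide cl X>lower X>upper (component-closed cl c) inside root
        (∖-intro {X = X} {members} Xu' (component-separates forest cl c vu vu' u≢u'))
      where
      c : Component X u
      c = component Xu
      open Component c

    relocate : ∀ {v X u X'} (cl : Closed v X) (X>lower : lower ℚ.< ℕtoℚ (count X)) → Closed u X' →
      count X' ℕ.< count X → ℕtoℚ (count (outside u X')) ℚ.≤ lower → Progress (state v X cl X>lower)
    relocate {v} {X} {u} {X'} cl X>lower X'-closed shrinks outside≤lower = choose (lower ℚ.<? ℕtoℚ (count X'))
      where
      choose : Dec (lower ℚ.< ℕtoℚ (count X')) → Progress (state v X cl X>lower)
      choose (yes X'>lower) = inj₂ (state u X' X'-closed X'>lower , shrinks)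
      choose (no  X'≯lower) = inj₁ (u , inj₁ (two-split X'-closed
        (ℚP.≤-trans (ℚP.≮⇒≥ X'≯lower) (lower≤upper 0≤ε)) (ℚP.≤-trans outside≤lower (lower≤upper 0≤ε))))

    advance : ∀ {v X} (cl : Closed v X) (X>lower : lower ℚ.< ℕtoℚ (count X)) → upper ℚ.< ℕtoℚ (count X) →
      ∀ {u} → X u ≡ true → (∀ {u'} → Adj T v u' → X u' ≡ true → u' ≡ u) → Progress (state v X cl X>lower)
    advance {v} {X} cl X>lower X>upper {u} Xu only =
      relocate cl X>lower (shift-closed cl Xu only) shrinks
        (complement-≤ (count (outside u X')) (count X) fits X>upper upper+lower)
      where
      X' : Subset n
      X' = X ∖ ⁅ u ⁆
      shrinks : count X' ℕ.< count X
      shrinks = subst (count X' ℕ.<_) (sym (count-remove {X = X} Xu)) (ℕP.n<1+n (count X'))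
      fits : count (outside u X') ℕ.+ count X ℕ.≤ n
      fits = ℕP.≤-reflexive (begin
        count (outside u X') ℕ.+ count X          ≡⟨ cong (count (outside u X') ℕ.+_) (count-remove {X = X} Xu) ⟩
        count (outside u X') ℕ.+ suc (count X')   ≡⟨ ℕP.+-suc (count (outside u X')) (count X') ⟩
        suc (count (outside u X') ℕ.+ count X')   ≡⟨ cong suc (ℕP.+-comm (count (outside u X')) (count X')) ⟩
        suc (count X' ℕ.+ count (outside u X'))   ≡⟨ count-outside (avoids (shift-closed cl Xu only)) ⟩
        n                                         ∎)
        where open ≡-Reasoning

    round : (s : State) → Progress s
    round (state v X cl X>lower) = by-size (ℕtoℚ (count X) ℚ.≤? upper)
      where
      by-size : Dec (ℕtoℚ (count X) ℚ.≤ upper) → Progress (state v X cl X>lower)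
      by-size (yes X≤upper) = inj₁ (v , inj₁ (two-split cl X≤upper (outside-≤-upper cl X>lower)))
      by-size (no  X≰upper) = by-shape (branching? v X)
        where
        X>upper : upper ℚ.< ℕtoℚ (count X)
        X>upper = ℚP.≰⇒> X≰upper
        by-shape : Dec (Branching v X) → Progress (state v X cl X>lower)
        by-shape (yes (u , u' , vu , Xu , vu' , Xu' , u≢u')) = branch cl X>lower X>upper vu Xu vu' Xu' u≢u'
        by-shape (no  ¬branching) =
          let (u , Xu , only) = pivot (exceeds-nonNeg⇒pos (count X) (upper-nonNeg 0≤ε) X>upper) ¬branching
          in advance cl X>lower X>upper Xu only

    descent : (s : State) → Acc ℕ._<_ (count (side s)) → Good
    descent s (acc smaller) = continue (round s)
      where
      continue : Progress s → Good
      continue (inj₁ good)          = good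
      continue (inj₂ (s' , shrinks)) = descent s' (smaller shrinks)

    launch : ∀ {v X} → Closed v X → ℕtoℚ (count (outside v X)) ℚ.≤ upper → Good
    launch {v} {X} cl outside≤upper = choose (lower ℚ.<? ℕtoℚ (count X))
      where
      choose : Dec (lower ℚ.< ℕtoℚ (count X)) → Good
      choose (yes X>lower) = descent (state v X cl X>lower) (<-wellFounded (count X))
      choose (no  X≯lower) = v , inj₁ (two-split cl (ℚP.≤-trans (ℚP.≮⇒≥ X≯lower) (lower≤upper 0≤ε)) outside≤upper)

    start : Fin n → Good
    start v = launch cl nothing-outside
      where
      X : Subset n
      X = ∁ ⁅ v ⁆
      cl : Closed v X
      cl = record { avoids = cong not (⁅⁆-self v) ; stable = λ _ w'≢v _ _ → cong not (⁅⁆-other w'≢v) }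
      nothing-outside : ℕtoℚ (count (outside v X)) ℚ.≤ upper
      nothing-outside = subst (λ k → ℕtoℚ k ℚ.≤ upper)
        (sym (trans (count-ext (λ w → ∧-inverseʳ (not (⁅ v ⁆ w)))) (count-empty n))) (upper-nonNeg 0≤ε)

open import Data.Nat using (suc; _≥_)
open import Data.Fin using (Fin; zero)
open import Data.Rational using (ℚ; 0ℚ; _≤_)
open import Data.Product using (∃)
open import Data.Sum using (_⊎_)

lemma1 : (n : ℕ) → n ≥ 1 → (T : Graph n) → IsForest T →
    (ε : ℚ) → 0ℚ ≤ ε →
    ∃ λ (v : Fin n) → Is2Split T ε v ⊎ Is3Split T ε v
-- Launch the descent of Splitting.Descent from the vertex zero.
lemma1 (suc m) _ T forest ε 0≤ε = Splitting.Descent.start T forest ε 0≤ε zero
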